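{- Let $n\ge1$, $[n]=\{1,\dots,n\}$, and let $(U_i)_{i\ge0}$ be any sequence of subsets of $[n]$, with the associated sequences $\mathrm{reset}_A$ ($A\subseteq[n]$) defined below. Then for every $i\ge0$, the set \[V_i:=\bigcup_{\mathrm{reset}_{U_i}(i)<h\le i}U_h\] is the unique subset of $[n]$ that completes a cycle at stage $i$.
   Context: Given $(U_i)_{i\ge0}$, the integer sequences $\mathrm{reset}_A$ for $A\subseteq[n]$ are defined by simultaneous recursion: $\mathrm{reset}_A(0):=-1$ for all $A\subseteq[n]$. Given that $\mathrm{reset}_A(i)$ is defined (and $<i$) for all $A$, a set $B\subseteq[n]$ is said to complete a cycle at stage $i$ if $\bigcup_{\mathrm{reset}_B(i)<h\le i}U_h=B$. Then for every $A\subseteq[n]$: $\mathrm{reset}_A(i+1):=i$ if some $B\supseteq A$ completes a cycle at stage $i$ (in which case $A$ is said to be reset at stage $i$), and $\mathrm{reset}_A(i+1):=\mathrm{reset}_A(i)$ otherwise. -}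

module Defs where

open import Data.Nat using (ℕ; zero; suc)
open import Data.Integer using (ℤ; +_; -1ℤ; _<?_)
open import Data.Bool using (Bool; if_then_else_)
open import Data.Bool.Properties using () renaming (_≟_ to _≟ᵇ_)
open import Data.List using (List; map; filter; upTo)
open import Data.Fin.Subset using (Subset; _⊆_; ⋃)
open import Data.Fin.Subset.Properties using (_⊆?_; anySubset?)
open import Data.Vec.Properties using (≡-dec)
open import Data.Product using (_×_; ∃)
open import Relation.Nullary using (Dec; does)
open import Relation.Nullary.Decidable using (_×-dec_)
open import Relation.Binary.PropositionalEquality using (_≡_)

-- Subsets of [n] are 'Subset n' (Fin n ≅ [n]); the sequence (U_i)_{i ≥ 0}
-- is a function ℕ → Subset n.

cycleUnion : ∀ {n} → (ℕ → Subset n) → ℤ → ℕ → Subset n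
cycleUnion U r i = ⋃ (map U (filter (λ h → r <? + h) (upTo (suc i))))

_≟ₛ_ : ∀ {n} (A B : Subset n) → Dec (A ≡ B)
_≟ₛ_ = ≡-dec _≟ᵇ_

mutual
  reset : ∀ {n} → (ℕ → Subset n) → ℕ → Subset n → ℤ
  reset U zero    A = -1ℤ
  reset U (suc i) A =
    if does (anySubset? (λ B → (A ⊆? B) ×-dec completesDec U i B))
    then + i
    else reset U i A

  completesDec : ∀ {n} (U : ℕ → Subset n) (i : ℕ) (B : Subset n) →
                 Dec (cycleUnion U (reset U i B) i ≡ B)
  completesDec U i B = cycleUnion U (reset U i B) i ≟ₛ B

CompletesCycle : ∀ {n} → (ℕ → Subset n) → ℕ → Subset n → Set
CompletesCycle U i B = cycleUnion U (reset U i B) i ≡ B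

V : ∀ {n} → (ℕ → Subset n) → ℕ → Subset n
V U i = cycleUnion U (reset U i (U i)) i

-- Induction on the stage i with an invariant on the reset times: they are
-- below i, antitone in A, if B was reset before A then A has been covered
-- by the U_h since B's reset, and only the empty set has been covered since
-- its own reset.  At stage i every B completing a cycle contains U_i, so
-- reset_B(i) ≤ reset_{U_i}(i); a strict inequality would make B covered since
-- its own reset, hence empty, so equal to U_i: absurd.  So reset_B(i) = reset_{U_i}(i)
-- and B = V_i.  The sets reset at stage i are then exactly the subsets of
-- V_i, from which the invariant at stage i + 1 follows.
module Submission where

open import Defs
open import Data.Nat using (ℕ; _≥_)
open import Data.Fin.Subset using (Subset)
open import Data.Product using (_×_)
open import Relation.Binary.PropositionalEquality using (_≡_)

open import Data.Nat as ℕ using (zero; suc; s≤s)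
import Data.Nat.Properties as ℕ
open import Data.Integer as ℤ using (ℤ; +_; -<+; +<+)
import Data.Integer.Properties as ℤ
open import Data.Fin using (Fin)
open import Data.Fin.Subset using (_∈_; _∉_; _⊆_; ⋃)
open import Data.Fin.Subset.Properties using (_⊆?_; ⊆-antisym; ⊆-reflexive; ⊆-trans; x∈p∪q⁺; x∈p∪q⁻; ∉⊥; anySubset?)
open import Data.List using (List; []; _∷_; map; filter; upTo)
open import Data.List.Membership.Propositional using () renaming (_∈_ to _∈ₗ_)
open import Data.List.Membership.Propositional.Properties
  using (∈-map⁻; ∈-map⁺; ∈-filter⁻; ∈-filter⁺; ∈-upTo⁻; ∈-upTo⁺)
open import Data.List.Relation.Unary.Any using (here; there)
open import Data.Product using (∃; _,_)
open import Data.Sum using (_⊎_; inj₁; inj₂)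
open import Data.Empty using (⊥-elim)
open import Relation.Nullary using (¬_; yes; no)
open import Relation.Nullary.Decidable using (_×-dec_)
open import Relation.Binary.PropositionalEquality using (refl; sym; cong; subst; module ≡-Reasoning)

x∈⋃⁻ : ∀ {n} {x : Fin n} (ps : List (Subset n)) → x ∈ ⋃ ps → ∃ λ p → p ∈ₗ ps × x ∈ p
x∈⋃⁻ []       x∈⋃ = ⊥-elim (∉⊥ x∈⋃)
x∈⋃⁻ (p ∷ ps) x∈⋃ with x∈p∪q⁻ p (⋃ ps) x∈⋃
... | inj₁ x∈p = p , here refl , x∈p
... | inj₂ x∈⋃ps with x∈⋃⁻ ps x∈⋃ps
...   | q , q∈ps , x∈q = q , there q∈ps , x∈q

x∈⋃⁺ : ∀ {n} {x : Fin n} {p} (ps : List (Subset n)) → p ∈ₗ ps → x ∈ p → x ∈ ⋃ ps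
x∈⋃⁺ (p ∷ ps) (here refl) x∈p = x∈p∪q⁺ (inj₁ x∈p)
x∈⋃⁺ (q ∷ ps) (there p∈ps) x∈p = x∈p∪q⁺ (inj₂ (x∈⋃⁺ ps p∈ps x∈p))

module _ {n : ℕ} (U : ℕ → Subset n) where

  -- x ∈ ⋃_{r < h < j} U_h: unlike cycleUnion, the upper bound j is exclusive.
  InWindow : ℤ → ℕ → Fin n → Set
  InWindow r j x = ∃ λ h → h ℕ.< j × r ℤ.< + h × x ∈ U h

  Covered : ℤ → ℕ → Subset n → Set
  Covered r j A = ∀ {x} → x ∈ A → InWindow r j x

  ∈cycleUnion⁻ : ∀ {r i x} → x ∈ cycleUnion U r i → InWindow r (suc i) x
  ∈cycleUnion⁻ {r} {i} x∈ with x∈⋃⁻ (map U (filter (λ h → r ℤ.<? + h) (upTo (suc i)))) x∈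
  ... | _ , p∈ , x∈p with ∈-map⁻ U p∈
  ...   | h , h∈ , refl with ∈-filter⁻ (λ h → r ℤ.<? + h) {xs = upTo (suc i)} h∈
  ...     | h∈upTo , r<h = h , ∈-upTo⁻ h∈upTo , r<h , x∈p

  ∈cycleUnion⁺ : ∀ {r i x} → InWindow r (suc i) x → x ∈ cycleUnion U r i
  ∈cycleUnion⁺ {r} {i} (h , h<1+i , r<h , x∈Uh) =
    x∈⋃⁺ (map U (filter (λ h → r ℤ.<? + h) (upTo (suc i))))
         (∈-map⁺ U (∈-filter⁺ (λ h → r ℤ.<? + h) (∈-upTo⁺ h<1+i) r<h)) x∈Uh

  InWindow-antiˡ : ∀ {r r′ j x} → r ℤ.≤ r′ → InWindow r′ j x → InWindow r j x
  InWindow-antiˡ r≤r′ (h , h<j , r′<h , x∈Uh) = h , h<j , ℤ.≤-<-trans r≤r′ r′<h , x∈Uh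

  InWindow-monoʳ : ∀ {r j j′ x} → j ℕ.≤ j′ → InWindow r j x → InWindow r j′ x
  InWindow-monoʳ j≤j′ (h , h<j , r<h , x∈Uh) = h , ℕ.<-≤-trans h<j j≤j′ , r<h , x∈Uh

  InWindow-last : ∀ {r i x} → r ℤ.< + i → x ∈ U i → InWindow r (suc i) x
  InWindow-last r<i x∈Ui = _ , ℕ.≤-refl , r<i , x∈Ui

  InWindow-suc⁻ : ∀ {r i x} → InWindow r (suc i) x → x ∈ U i ⊎ InWindow r i x
  InWindow-suc⁻ (h , s≤s h≤i , r<h , x∈Uh) with ℕ.m≤n⇒m<n∨m≡n h≤i
  ... | inj₁ h<i  = inj₂ (h , h<i , r<h , x∈Uh)
  ... | inj₂ refl = inj₁ x∈Uh

  ¬InWindow-0 : ∀ {r x} → ¬ InWindow r 0 x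
  ¬InWindow-0 (_ , () , _)

  ¬InWindow-i-1+i : ∀ {i x} → ¬ InWindow (+ i) (suc i) x
  ¬InWindow-i-1+i (_ , s≤s h≤i , +<+ i<h , _) = ℕ.<⇒≱ i<h h≤i

  cycleUnion-anti : ∀ {r r′ i} → r ℤ.≤ r′ → cycleUnion U r′ i ⊆ cycleUnion U r i
  cycleUnion-anti r≤r′ x∈ = ∈cycleUnion⁺ (InWindow-antiˡ r≤r′ (∈cycleUnion⁻ x∈))

  record ResetInvariant (i : ℕ) : Set where
    field
      reset<stage    : ∀ A → reset U i A ℤ.< + i
      reset-antitone : ∀ {A B} → A ⊆ B → reset U i B ℤ.≤ reset U i A
      reset<⇒Covered : ∀ {A B} → reset U i B ℤ.< reset U i A → Covered (reset U i B) i A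
      Covered⇒empty  : ∀ {A} → Covered (reset U i A) i A → ∀ {x} → x ∉ A

  ResetInvariant-0 : ResetInvariant 0
  ResetInvariant-0 = record
    { reset<stage    = λ _ → -<+
    ; reset-antitone = λ _ → ℤ.≤-refl
    ; reset<⇒Covered = λ r<r → ⊥-elim (ℤ.<-irrefl refl r<r)
    ; Covered⇒empty  = λ covered x∈A → ¬InWindow-0 (covered x∈A)
    }

  module Stage (i : ℕ) (I : ResetInvariant i) where
    open ResetInvariant I

    R : Subset n → ℤ
    R = reset U i

    s : ℤ
    s = R (U i)

    Vᵢ : Subset n
    Vᵢ = V U i

    Uᵢ⊆cycleUnion : ∀ A → U i ⊆ cycleUnion U (R A) i
    Uᵢ⊆cycleUnion A x∈Ui = ∈cycleUnion⁺ (InWindow-last (reset<stage A) x∈Ui)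

    reset<s⇒empty : ∀ {B} → R B ℤ.< s → B ⊆ cycleUnion U (R B) i → ∀ {x} → x ∉ B
    reset<s⇒empty {B} RB<s B⊆ = Covered⇒empty covered
      where
        covered : Covered (R B) i B
        covered x∈B with InWindow-suc⁻ (∈cycleUnion⁻ (B⊆ x∈B))
        ... | inj₁ x∈Ui = reset<⇒Covered {U i} {B} RB<s x∈Ui
        ... | inj₂ x∈W  = x∈W

    reset≡s : ∀ {B} → U i ⊆ B → B ⊆ cycleUnion U (R B) i → R B ≡ s
    reset≡s {B} Ui⊆B B⊆ = ℤ.≤∧≮⇒≡ (reset-antitone Ui⊆B) RB≮s
      where
        RB≮s : ¬ R B ℤ.< s
        RB≮s RB<s = ℤ.<-irrefl (cong R (sym Ui≡B)) RB<s
          where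
            Ui≡B : U i ≡ B
            Ui≡B = ⊆-antisym Ui⊆B (λ x∈B → ⊥-elim (reset<s⇒empty RB<s B⊆ x∈B))

    Vᵢ-completes : CompletesCycle U i Vᵢ
    Vᵢ-completes = cong (λ r → cycleUnion U r i) (reset≡s (Uᵢ⊆cycleUnion (U i)) Vᵢ⊆)
      where
        Vᵢ⊆ : Vᵢ ⊆ cycleUnion U (R Vᵢ) i
        Vᵢ⊆ = cycleUnion-anti (reset-antitone (Uᵢ⊆cycleUnion (U i)))

    completes⇒≡Vᵢ : ∀ B → CompletesCycle U i B → B ≡ Vᵢ
    completes⇒≡Vᵢ B completes = begin
      B                     ≡⟨ sym completes ⟩
      cycleUnion U (R B) i  ≡⟨ cong (λ r → cycleUnion U r i) (reset≡s Uᵢ⊆B (⊆-reflexive (sym completes))) ⟩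
      Vᵢ                    ∎
      where
        open ≡-Reasoning
        Uᵢ⊆B : U i ⊆ B
        Uᵢ⊆B = subst (U i ⊆_) completes (Uᵢ⊆cycleUnion B)

    ⊆cycleUnion⇒⊆Vᵢ : ∀ {A} → A ⊆ cycleUnion U (R A) i → A ⊆ Vᵢ
    ⊆cycleUnion⇒⊆Vᵢ {A} A⊆ x∈A with R A ℤ.<? s
    ... | yes RA<s = ⊥-elim (reset<s⇒empty RA<s A⊆ x∈A)
    ... | no  RA≮s = cycleUnion-anti (ℤ.≮⇒≥ RA≮s) (A⊆ x∈A)

    ⊈Vᵢ⇒reset≤s : ∀ {B} → ¬ B ⊆ Vᵢ → R B ℤ.≤ s
    ⊈Vᵢ⇒reset≤s {B} B⊈Vᵢ = ℤ.≮⇒≥ λ s<RB → B⊈Vᵢ λ x∈B →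
      ∈cycleUnion⁺ (InWindow-monoʳ (ℕ.n≤1+n i) (reset<⇒Covered {B} {U i} s<RB x∈B))

    reset-suc-⊆Vᵢ : ∀ {A} → A ⊆ Vᵢ → reset U (suc i) A ≡ + i
    reset-suc-⊆Vᵢ {A} A⊆Vᵢ with anySubset? (λ B → (A ⊆? B) ×-dec completesDec U i B)
    ... | yes _       = refl
    ... | no no-cycle = ⊥-elim (no-cycle (Vᵢ , A⊆Vᵢ , Vᵢ-completes))

    reset-suc-⊈Vᵢ : ∀ {A} → ¬ A ⊆ Vᵢ → reset U (suc i) A ≡ R A
    reset-suc-⊈Vᵢ {A} A⊈Vᵢ with anySubset? (λ B → (A ⊆? B) ×-dec completesDec U i B)
    ... | yes (B , A⊆B , B-completes) =
          ⊥-elim (A⊈Vᵢ (⊆-trans A⊆B (⊆-reflexive (completes⇒≡Vᵢ B B-completes))))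
    ... | no _ = refl

    reset-suc≤stage : ∀ A → reset U (suc i) A ℤ.≤ + i
    reset-suc≤stage A with A ⊆? Vᵢ
    ... | yes A⊆Vᵢ rewrite reset-suc-⊆Vᵢ A⊆Vᵢ = ℤ.≤-refl
    ... | no  A⊈Vᵢ rewrite reset-suc-⊈Vᵢ A⊈Vᵢ = ℤ.<⇒≤ (reset<stage A)

    reset-suc-antitone : ∀ {A B} → A ⊆ B → reset U (suc i) B ℤ.≤ reset U (suc i) A
    reset-suc-antitone {A} {B} A⊆B with A ⊆? Vᵢ
    ... | yes A⊆Vᵢ rewrite reset-suc-⊆Vᵢ A⊆Vᵢ = reset-suc≤stage B
    ... | no  A⊈Vᵢ rewrite reset-suc-⊈Vᵢ A⊈Vᵢ
                         | reset-suc-⊈Vᵢ (λ B⊆Vᵢ → A⊈Vᵢ (⊆-trans A⊆B B⊆Vᵢ)) = reset-antitone A⊆B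

    reset-suc<⇒Covered : ∀ {A B} → reset U (suc i) B ℤ.< reset U (suc i) A →
                         Covered (reset U (suc i) B) (suc i) A
    reset-suc<⇒Covered {A} {B} RB<RA x∈A with B ⊆? Vᵢ
    ... | yes B⊆Vᵢ rewrite reset-suc-⊆Vᵢ B⊆Vᵢ = ⊥-elim (ℤ.<⇒≱ RB<RA (reset-suc≤stage A))
    ... | no  B⊈Vᵢ rewrite reset-suc-⊈Vᵢ B⊈Vᵢ with A ⊆? Vᵢ
    ...   | yes A⊆Vᵢ = InWindow-antiˡ (⊈Vᵢ⇒reset≤s B⊈Vᵢ) (∈cycleUnion⁻ (A⊆Vᵢ x∈A))
    ...   | no  A⊈Vᵢ rewrite reset-suc-⊈Vᵢ A⊈Vᵢ =
            InWindow-monoʳ (ℕ.n≤1+n i) (reset<⇒Covered RB<RA x∈A)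

    Covered-suc⇒empty : ∀ {A} → Covered (reset U (suc i) A) (suc i) A → ∀ {x} → x ∉ A
    Covered-suc⇒empty {A} covered x∈A with A ⊆? Vᵢ
    ... | yes A⊆Vᵢ rewrite reset-suc-⊆Vᵢ A⊆Vᵢ = ¬InWindow-i-1+i (covered x∈A)
    ... | no  A⊈Vᵢ rewrite reset-suc-⊈Vᵢ A⊈Vᵢ =
          A⊈Vᵢ (⊆cycleUnion⇒⊆Vᵢ (λ y∈A → ∈cycleUnion⁺ (covered y∈A)))

    ResetInvariant-suc : ResetInvariant (suc i)
    ResetInvariant-suc = record
      { reset<stage    = λ A → ℤ.≤-<-trans (reset-suc≤stage A) (+<+ ℕ.≤-refl)
      ; reset-antitone = reset-suc-antitone
      ; reset<⇒Covered = reset-suc<⇒Covered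
      ; Covered⇒empty  = Covered-suc⇒empty
      }

  resetInvariant : ∀ i → ResetInvariant i
  resetInvariant zero    = ResetInvariant-0
  resetInvariant (suc i) = Stage.ResetInvariant-suc i (resetInvariant i)

mainTheorem16 : (n : ℕ) → n ≥ 1 → (U : ℕ → Subset n) → (i : ℕ) →
    CompletesCycle U i (V U i) × ((B : Subset n) → CompletesCycle U i B → B ≡ V U i)
mainTheorem16 n _ U i = Vᵢ-completes , completes⇒≡Vᵢ
  where open Stage U i (resetInvariant U i)
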